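{- For any positive integer $m$, any two words of length $m$ that are permutations of $\{1,2,\dots,m\}$ (each letter appearing exactly once) are cyclic Knuth equivalent.
   Context: A word is a finite sequence of letters from a totally ordered set. Transformation $K'$: if $yzx$ are three consecutive letters with $x<y\le z$, replace them by $yxz$. Transformation $K''$: if $xzy$ are three consecutive letters with $x\le y<z$, replace them by $zxy$. An elementary Knuth transformation is $K'$, $K''$, or the inverse of either. The rotation $R$ moves the rightmost letter of a word to the leftmost position. An elementary cyclic Knuth transformation is an elementary Knuth transformation or $R$. Two words are cyclic Knuth equivalent if one can be obtained from the other by a finite sequence of elementary cyclic Knuth transformations. -}

module Defs where

open import Data.Nat using (ℕ; suc; _≤_; _<_)
open import Data.List using (List; []; _∷_; _++_; [_]; map; upTo)
open import Relation.Binary.Construct.Closure.ReflexiveTransitive using (Star)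

Word : Set
Word = List ℕ

data Knuth₁ : Word → Word → Set where
  K′  : ∀ (u v : Word) {x y z : ℕ} → x < y → y ≤ z →
        Knuth₁ (u ++ y ∷ z ∷ x ∷ v) (u ++ y ∷ x ∷ z ∷ v)
  K″ : ∀ (u v : Word) {x y z : ℕ} → x ≤ y → y < z →
        Knuth₁ (u ++ x ∷ z ∷ y ∷ v) (u ++ z ∷ x ∷ y ∷ v)

data Rot : Word → Word → Set where
  R : ∀ (w : Word) (a : ℕ) → Rot (w ++ [ a ]) (a ∷ w)

data CycStep : Word → Word → Set where
  knuth    : ∀ {u v} → Knuth₁ u v → CycStep u v
  knuthInv : ∀ {u v} → Knuth₁ v u → CycStep u v
  rot      : ∀ {u v} → Rot u v → CycStep u v

_∼cyc_ : Word → Word → Set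
u ∼cyc v = Star CycStep u v

oneTo : ℕ → Word
oneTo m = map suc (upTo m)

-- Call a rotation guarded if the letter it brings to the front is at most the
-- current first letter.  Behind a larger letter M a guarded rotation is still
-- available: M b t a ↦ a M b t (a guarded rotation, a ≤ M) ↦ M a b t (K″,
-- a ≤ b < M).  Hence equivalence under Knuth moves and guarded rotations
-- passes from s to M s, and by induction on m it suffices to bring the largest
-- letter M of a word p M q to the front with these moves.  If p begins with a
-- weak ascent, a guarded rotation sends its first letter to the far end.  A
-- descent c₁ > c₂ at the front of p is pushed forward by Knuth moves: it turns
-- into a weak ascent unless p is strictly decreasing to its end, and then K′
-- lets M jump over the last letter of p.  Either way p gets shorter.
module Submission where

open import Defs
open import Data.Nat using (ℕ; _≤_)
open import Data.List.Relation.Binary.Permutation.Propositional using (_↭_)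

open import Data.Nat using (zero; suc; _+_; _<_; z≤n; s≤s; _≤?_)
open import Data.Nat.Induction using (<-wellFounded)
open import Data.Nat.Properties
  using (≤-refl; ≤-reflexive; <⇒≤; ≰⇒>; m≤n⇒m≤1+n; +-cancelʳ-≡; +-monoʳ-<)
open import Data.List using ([]; _∷_; _++_; [_]; _∷ʳ_; map; upTo; length; reverse)
open import Data.List.Properties
  using (++-assoc; ++-identityʳ; map-++; upTo-∷ʳ; length-++; unfold-reverse; reverse-involutive)
open import Data.List.Relation.Unary.All as All using (All; []; _∷_)
open import Data.List.Relation.Unary.All.Properties using (++⁻ˡ; ++⁻ʳ; map⁺; all-upTo)
open import Data.List.Relation.Unary.Any using (here)
open import Data.List.Membership.Propositional using (_∈_)
open import Data.List.Membership.Propositional.Properties using (∈-∃++)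
open import Data.List.Relation.Binary.Permutation.Propositional
  using (prep; swap; ↭-refl; ↭-sym; ↭-trans; ↭-isEquivalence)
open import Data.List.Relation.Binary.Permutation.Propositional.Properties
  using (All-resp-↭; ∈-resp-↭; drop-∷; ++⁺ˡ; ∷↭∷ʳ; ↭-empty-inv; ↭-length)
open import Relation.Binary.Construct.Closure.ReflexiveTransitive
  using (ε; _◅_; _◅◅_; _⋆)
open import Relation.Binary.Construct.Closure.Symmetric using (SymClosure; fwd; bwd)
open import Relation.Binary.Construct.Closure.Equivalence as EqClosure using (EqClosure)
open import Relation.Binary.Construct.Union using (_∪_)
open import Relation.Binary.PropositionalEquality
  using (_≡_; refl; sym; cong; subst; subst₂; module ≡-Reasoning)
open import Induction.WellFounded using (Acc; acc)
open import Data.Product using (∃-syntax; _×_; _,_)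
open import Data.Sum as Sum using (_⊎_; inj₁; inj₂)
open import Relation.Nullary using (yes; no)

data GuardedRot : Word → Word → Set where
  guardedRot : ∀ {a b} t → a ≤ b → GuardedRot (b ∷ t ++ [ a ]) (a ∷ b ∷ t)

_≈ᴷ_ : Word → Word → Set
_≈ᴷ_ = EqClosure Knuth₁

_≈ᵍ_ : Word → Word → Set
_≈ᵍ_ = EqClosure (Knuth₁ ∪ GuardedRot)

≈ᴷ⇒≈ᵍ : ∀ {u v} → u ≈ᴷ v → u ≈ᵍ v
≈ᴷ⇒≈ᵍ = EqClosure.map inj₁

knuth₁⇒↭ : ∀ {u v} → Knuth₁ u v → u ↭ v
knuth₁⇒↭ (K′ u _ {x} {y} {z} _ _) = ++⁺ˡ u (prep y (swap z x ↭-refl))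
knuth₁⇒↭ (K″ u _ {x} {_} {z} _ _) = ++⁺ˡ u (swap x z ↭-refl)

guardedRot⇒↭ : ∀ {u v} → GuardedRot u v → u ↭ v
guardedRot⇒↭ (guardedRot {a} {b} t _) = ↭-sym (∷↭∷ʳ a (b ∷ t))

≈ᵍ⇒↭ : ∀ {u v} → u ≈ᵍ v → u ↭ v
≈ᵍ⇒↭ = EqClosure.fold ↭-isEquivalence Sum.[ knuth₁⇒↭ , guardedRot⇒↭ ]

≈ᴷ-++ʳ-length : ∀ w {w′ t} → (w ++ t) ≈ᴷ (w′ ++ t) → length w ≡ length w′
≈ᴷ-++ʳ-length w {w′} {t} eq = +-cancelʳ-≡ (length t) (length w) (length w′) (begin
  length w + length t    ≡⟨ sym (length-++ w) ⟩
  length (w ++ t)        ≡⟨ ↭-length (≈ᵍ⇒↭ (≈ᴷ⇒≈ᵍ eq)) ⟩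
  length (w′ ++ t)       ≡⟨ length-++ w′ ⟩
  length w′ + length t   ∎)
  where open ≡-Reasoning

rotate-reverse : ∀ r x → (x ++ reverse r) ∼cyc (reverse r ++ x)
rotate-reverse [] x rewrite ++-identityʳ x = ε
rotate-reverse (c ∷ r) x
  rewrite unfold-reverse c r | sym (++-assoc x (reverse r) [ c ]) | ++-assoc (reverse r) [ c ] x
  = rot (R (x ++ reverse r) c) ◅ rotate-reverse r (c ∷ x)

rotate : ∀ x y → (x ++ y) ∼cyc (y ++ x)
rotate x y =
  subst (λ y → (x ++ y) ∼cyc (y ++ x)) (reverse-involutive y) (rotate-reverse (reverse y) x)

step⇒∼cyc : ∀ {u v} → SymClosure (Knuth₁ ∪ GuardedRot) u v → u ∼cyc v
step⇒∼cyc (fwd (inj₁ k)) = knuth k ◅ ε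
step⇒∼cyc (bwd (inj₁ k)) = knuthInv k ◅ ε
step⇒∼cyc (fwd (inj₂ (guardedRot {a} {b} t _))) = rot (R (b ∷ t) a) ◅ ε
step⇒∼cyc (bwd (inj₂ (guardedRot {a} {b} t _))) = rotate [ a ] (b ∷ t)

≈ᵍ⇒∼cyc : ∀ {u v} → u ≈ᵍ v → u ∼cyc v
≈ᵍ⇒∼cyc = step⇒∼cyc ⋆

knuth₁-∷ : ∀ c {u v} → Knuth₁ u v → Knuth₁ (c ∷ u) (c ∷ v)
knuth₁-∷ c (K′ u v x<y y≤z) = K′ (c ∷ u) v x<y y≤z
knuth₁-∷ c (K″ u v x≤y y<z) = K″ (c ∷ u) v x≤y y<z

≈ᴷ-∷ : ∀ c {u v} → u ≈ᴷ v → (c ∷ u) ≈ᴷ (c ∷ v)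
≈ᴷ-∷ c = EqClosure.gmap (c ∷_) (knuth₁-∷ c)

guardedRot-∷-max : ∀ {M u v} → All (_< M) u → GuardedRot u v → (M ∷ u) ≈ᵍ (M ∷ v)
guardedRot-∷-max {M} (b<M ∷ t++a<M) (guardedRot {a} t a≤b) =
  fwd (inj₂ (guardedRot (_ ∷ t) (<⇒≤ a<M))) ◅ fwd (inj₁ (K″ [] t a≤b b<M)) ◅ ε
  where
  a<M : a < M
  a<M with ++⁻ʳ t t++a<M
  ... | a<M ∷ [] = a<M

step-∷-max : ∀ {M u v} → All (_< M) u → (Knuth₁ ∪ GuardedRot) u v → (M ∷ u) ≈ᵍ (M ∷ v)
step-∷-max {M} _   (inj₁ k) = fwd (inj₁ (knuth₁-∷ M k)) ◅ ε
step-∷-max     u<M (inj₂ r) = guardedRot-∷-max u<M r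

≈ᵍ-∷-max : ∀ {M u v} → All (_< M) u → u ≈ᵍ v → (M ∷ u) ≈ᵍ (M ∷ v)
≈ᵍ-∷-max _ ε = ε
≈ᵍ-∷-max {M} {u} u<M (_◅_ {j = v} s ss) = lift s ◅◅ ≈ᵍ-∷-max v<M ss
  where
  v<M : All (_< M) v
  v<M = All-resp-↭ (≈ᵍ⇒↭ (s ◅ ε)) u<M
  lift : SymClosure (Knuth₁ ∪ GuardedRot) u v → (M ∷ u) ≈ᵍ (M ∷ v)
  lift (fwd s) = step-∷-max u<M s
  lift (bwd s) = EqClosure.symmetric _ (step-∷-max v<M s)

record AscentForm (w t : Word) : Set where
  constructor ascentForm
  field
    a b  : ℕ
    rest : Word
    a≤b  : a ≤ b
    knuthEquiv : (w ++ t) ≈ᴷ (a ∷ b ∷ rest ++ t)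

data FinalDescent : Word → Set where
  finalDescent : ∀ init {a b} → b < a → FinalDescent (init ++ a ∷ b ∷ [])

ascentForm-∷ : ∀ c {w t} → AscentForm w t → AscentForm (c ∷ w) t
ascentForm-∷ c {t = t} (ascentForm a b rest a≤b eq) with c ≤? a | c ≤? b
... | yes c≤a | _       = ascentForm c a (b ∷ rest) c≤a (≈ᴷ-∷ c eq)
... | no c≰a  | yes c≤b =
  ascentForm c b (a ∷ rest) c≤b (≈ᴷ-∷ c eq ◅◅ bwd (K′ [] (rest ++ t) (≰⇒> c≰a) c≤b) ◅ ε)
... | no c≰a  | no c≰b  =
  ascentForm a c (b ∷ rest) (<⇒≤ (≰⇒> c≰a))
    (≈ᴷ-∷ c eq ◅◅ bwd (K″ [] (rest ++ t) a≤b (≰⇒> c≰b)) ◅ ε)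

finalDescent-∷ : ∀ c {w} → FinalDescent w → FinalDescent (c ∷ w)
finalDescent-∷ c (finalDescent init b<a) = finalDescent (c ∷ init) b<a

ascentForm⊎finalDescent : ∀ c₁ c₂ r t →
                          AscentForm (c₁ ∷ c₂ ∷ r) t ⊎ FinalDescent (c₁ ∷ c₂ ∷ r)
ascentForm⊎finalDescent c₁ c₂ r t with c₁ ≤? c₂
... | yes c₁≤c₂ = inj₁ (ascentForm c₁ c₂ r c₁≤c₂ ε)
ascentForm⊎finalDescent c₁ c₂ []      t | no c₁≰c₂ = inj₂ (finalDescent [] (≰⇒> c₁≰c₂))
ascentForm⊎finalDescent c₁ c₂ (c₃ ∷ r) t | no _    =
  Sum.map (ascentForm-∷ c₁) (finalDescent-∷ c₁) (ascentForm⊎finalDescent c₂ c₃ r t)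

record MaxAdvance (M : ℕ) (p q : Word) : Set where
  constructor advance
  field
    p′ q′   : Word
    shorter : length p′ < length p
    equiv   : (p ++ M ∷ q) ≈ᵍ (p′ ++ M ∷ q′)

advance-ascent : ∀ {M} p q → AscentForm p (M ∷ q) → MaxAdvance M p q
advance-ascent {M} p q (ascentForm a b rest a≤b eq) =
  advance (b ∷ rest) (q ++ [ a ]) (≤-reflexive (sym (≈ᴷ-++ʳ-length p {a ∷ b ∷ rest} eq)))
    (≈ᴷ⇒≈ᵍ eq ◅◅ subst (λ w → (a ∷ b ∷ rest ++ M ∷ q) ≈ᵍ (b ∷ w))
                        (++-assoc rest (M ∷ q) [ a ])
                        (bwd (inj₂ (guardedRot (rest ++ M ∷ q) a≤b)) ◅ ε))

advance-finalDescent : ∀ {M} p q → FinalDescent p → All (_≤ M) p → MaxAdvance M p q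
advance-finalDescent {M} .(init ++ a ∷ b ∷ []) q (finalDescent init {a} {b} b<a) p≤M =
  advance (init ++ [ a ]) (b ∷ q) shorter
    (subst₂ _≈ᵍ_ (sym (++-assoc init (a ∷ b ∷ []) (M ∷ q)))
                 (sym (++-assoc init [ a ] (M ∷ b ∷ q)))
                 (bwd (inj₁ (K′ init q b<a a≤M)) ◅ ε))
  where
  a≤M : a ≤ M
  a≤M with ++⁻ʳ init p≤M
  ... | a≤M ∷ _ = a≤M
  shorter : length (init ++ [ a ]) < length (init ++ a ∷ b ∷ [])
  shorter = subst₂ _<_ (sym (length-++ init)) (sym (length-++ init))
                       (+-monoʳ-< (length init) ≤-refl)

maxAdvance : ∀ {M} c p q → All (_≤ M) (c ∷ p) → MaxAdvance M (c ∷ p) q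
maxAdvance c [] q (c≤M ∷ []) =
  advance [] (q ++ [ c ]) (s≤s z≤n) (bwd (inj₂ (guardedRot q c≤M)) ◅ ε)
maxAdvance {M} c₁ (c₂ ∷ r) q p≤M with ascentForm⊎finalDescent c₁ c₂ r (M ∷ q)
... | inj₁ form = advance-ascent (c₁ ∷ c₂ ∷ r) q form
... | inj₂ descent = advance-finalDescent (c₁ ∷ c₂ ∷ r) q descent p≤M

max-to-front-acc : ∀ {M} p q → All (_≤ M) (p ++ M ∷ q) → Acc _<_ (length p) →
                   ∃[ s ] (p ++ M ∷ q) ≈ᵍ (M ∷ s)
max-to-front-acc []      q _   _        = q , ε
max-to-front-acc (c ∷ p) q w≤M (acc rs) with maxAdvance c p q (++⁻ˡ (c ∷ p) w≤M)
... | advance p′ q′ shorter eq with max-to-front-acc p′ q′ (All-resp-↭ (≈ᵍ⇒↭ eq) w≤M) (rs shorter)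
...   | s , eq′ = s , eq ◅◅ eq′

max-to-front : ∀ {M w} → M ∈ w → All (_≤ M) w → ∃[ s ] w ≈ᵍ (M ∷ s)
max-to-front M∈w w≤M with ∈-∃++ M∈w
... | p , q , refl = max-to-front-acc p q w≤M (<-wellFounded (length p))

oneTo-bounded : ∀ m → All (_≤ m) (oneTo m)
oneTo-bounded m = map⁺ (all-upTo m)

oneTo-suc : ∀ m → oneTo (suc m) ↭ suc m ∷ oneTo m
oneTo-suc m = subst (_↭ suc m ∷ oneTo m) oneTo-∷ʳ (↭-sym (∷↭∷ʳ (suc m) (oneTo m)))
  where
  oneTo-∷ʳ : oneTo m ∷ʳ suc m ≡ oneTo (suc m)
  oneTo-∷ʳ = begin
    map suc (upTo m) ∷ʳ suc m   ≡⟨ map-++ suc (upTo m) [ m ] ⟨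
    map suc (upTo m ∷ʳ m)       ≡⟨ cong (map suc) (upTo-∷ʳ m) ⟩
    oneTo (suc m)               ∎
    where open ≡-Reasoning

max-to-front-↭ : ∀ {m u} → u ↭ oneTo (suc m) → ∃[ s ] u ≈ᵍ (suc m ∷ s) × s ↭ oneTo m
max-to-front-↭ {m} {u} u↭ =
  let s , eq = max-to-front (∈-resp-↭ (↭-sym u↭′) (here refl)) (All-resp-↭ (↭-sym u↭′) bounded)
  in  s , eq , drop-∷ (↭-trans (↭-sym (≈ᵍ⇒↭ eq)) u↭′)
  where
  u↭′ : u ↭ suc m ∷ oneTo m
  u↭′ = ↭-trans u↭ (oneTo-suc m)
  bounded : All (_≤ suc m) (suc m ∷ oneTo m)
  bounded = ≤-refl ∷ All.map m≤n⇒m≤1+n (oneTo-bounded m)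

oneTo-permutations-≈ᵍ : ∀ m {u v} → u ↭ oneTo m → v ↭ oneTo m → u ≈ᵍ v
oneTo-permutations-≈ᵍ zero u↭ v↭ with ↭-empty-inv u↭ | ↭-empty-inv v↭
... | refl | refl = ε
oneTo-permutations-≈ᵍ (suc m) u↭ v↭ with max-to-front-↭ u↭ | max-to-front-↭ v↭
... | s , u≈ , s↭ | s′ , v≈ , s′↭ =
  u≈ ◅◅ ≈ᵍ-∷-max s<1+m (oneTo-permutations-≈ᵍ m s↭ s′↭) ◅◅ EqClosure.symmetric _ v≈
  where
  s<1+m : All (_< suc m) s
  s<1+m = All-resp-↭ (↭-sym s↭) (All.map s≤s (oneTo-bounded m))

mainTheorem7 : (m : ℕ) → 1 ≤ m → (u v : Word) → u ↭ oneTo m → v ↭ oneTo m →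
    u ∼cyc v
mainTheorem7 m _ u v u↭ v↭ = ≈ᵍ⇒∼cyc (oneTo-permutations-≈ᵍ m u↭ v↭)
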